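{- Let $S$ be any language over an alphabet $\Sigma$ with $S\in\mathrm{REG}/n$. Then there exists a positive integer $m$ such that for any numbers $n,\ell_1,\ell_2\in\mathbb{N}$ with $\ell_1+\ell_2=n$ there are pairwise disjoint sets $S_1^{(n)},\ldots,S_m^{(n)}$ such that (i) $S\cap\Sigma^n=\bigcup_{i=1}^m S_i^{(n)}$, and (ii) for each $i$ and any $x,y\in S_i^{(n)}$, writing $x=x_1x_2$ and $y=y_1y_2$ with $|x_1|=|y_1|=\ell_1$ and $|x_2|=|y_2|=\ell_2$, the strings $x_1y_2$ and $y_1x_2$ belong to $S_i^{(n)}$.
   Context: $\mathrm{REG}/n$ is the family of languages $L$ over $\Sigma$ for which there exist an alphabet $\Gamma$, $h:\mathbb{N}\to\Gamma^*$ with $|h(n)|=n$, and a regular language $A$ over $\Sigma\times\Gamma$ with $x\in L$ iff $\left[\begin{smallmatrix}x\\ h(|x|)\end{smallmatrix}\right]\in A$ for all $x\in\Sigma^*$, where $\left[\begin{smallmatrix}x_1\cdots x_n\\ y_1\cdots y_n\end{smallmatrix}\right]=(x_1,y_1)\cdots(x_n,y_n)$. -}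

module Defs where

open import Data.Nat using (ℕ)
open import Data.Fin using (Fin)
open import Data.Bool using (Bool; T)
open import Data.List using (List; []; _∷_; length; foldl)
open import Data.Product using (_×_; Σ; ∃; ∃-syntax)
open import Data.Vec as Vec using (Vec)
open import Function.Bundles using (_⇔_)

record DFA (A : Set) : Set where
  field
    states    : ℕ
    start     : Fin states
    step      : Fin states → A → Fin states
    accepting : Fin states → Bool

Accepts : {A : Set} → DFA A → List A → Set
Accepts M w = T (DFA.accepting M (foldl (DFA.step M) (DFA.start M) w))

Language : Set → Set₁
Language A = List A → Set

IsRegular : {A : Set} → Language A → Set
IsRegular {A} L = Σ (DFA A) λ M → ∀ w → L w ⇔ Accepts M w

track : {A B : Set} {n : ℕ} → Vec A n → Vec B n → List (A × B)
track x y = Vec.toList (Vec.zip x y)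

-- REG/n over the alphabet Σ = Fin k : there exist an advice alphabet Γ = Fin g,
-- an advice function h with |h(n)| = n, and a regular language R over Σ × Γ
-- such that x ∈ L iff [x ; h(|x|)] ∈ R.
REG/n : {k : ℕ} → Language (Fin k) → Set₁
REG/n {k} L =
  Σ ℕ λ g → Σ ((n : ℕ) → Vec (Fin g) n) λ h → Σ (Language (Fin k × Fin g)) λ R →
    IsRegular R × (∀ (x : List (Fin k)) → L x ⇔ R (track (Vec.fromList x) (h (length x))))

-- Run the automaton for the advice language on the track [x ; h(n)]. For fixed
-- n = ℓ₁ + ℓ₂ the advice is fixed, so the state reached after ℓ₁ letters depends
-- only on the prefix of x, and acceptance from there only on that state and the
-- suffix. Grouping the words of S ∩ Σⁿ by this cut state gives at most as many
-- classes as the automaton has states, independently of n, and two words with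
-- the same cut state can exchange their suffixes.
module Submission where

open import Defs
open import Data.Nat using (ℕ; _+_; _<_)
open import Data.Nat.Base using (>-nonZero⁻¹)
open import Data.Fin using (Fin)
open import Data.Fin.Properties using (nonZeroIndex)
open import Data.List using (List; length; foldl)
import Data.List as List
open import Data.List.Properties using (foldl-++)
open import Data.Vec using (Vec; toList; _++_; take; drop; fromList; zip)
open import Data.Vec.Properties
  using (take++drop≡id; ++-injective; zipWith-++; toList-++; length-toList; fromList∘toList)
open import Data.Vec.Relation.Binary.Equality.Cast using (_≈[_]_; cast-is-id)
open import Data.Bool using (T)
open import Data.Product using (_×_; Σ; ∃; ∃-syntax; _,_; proj₁; proj₂)
open import Function using (id)
open import Function.Bundles using (_⇔_; mk⇔)
open import Function.Properties.Equivalence using () renaming (trans to ⇔-trans)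
open import Relation.Binary.PropositionalEquality
  using (_≡_; refl; sym; trans; cong; cong₂; subst; module ≡-Reasoning)

module _ {A : Set} where

  take-++ : ∀ {m n} (x₁ : Vec A m) (x₂ : Vec A n) → take m (x₁ ++ x₂) ≡ x₁
  take-++ {m} x₁ x₂ = proj₁ (++-injective (take m (x₁ ++ x₂)) x₁ (take++drop≡id m (x₁ ++ x₂)))

  drop-++ : ∀ {m n} (x₁ : Vec A m) (x₂ : Vec A n) → drop m (x₁ ++ x₂) ≡ x₂
  drop-++ {m} x₁ x₂ = proj₂ (++-injective (take m (x₁ ++ x₂)) x₁ (take++drop≡id m (x₁ ++ x₂)))

module _ {A B : Set} where

  track-++ : ∀ {m n} (x₁ : Vec A m) (x₂ : Vec A n) (a₁ : Vec B m) (a₂ : Vec B n) →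
    track (x₁ ++ x₂) (a₁ ++ a₂) ≡ track x₁ a₁ List.++ track x₂ a₂
  track-++ x₁ x₂ a₁ a₂ = trans (cong toList (zipWith-++ _,_ x₁ x₂ a₁ a₂))
                               (toList-++ (zip x₁ a₁) (zip x₂ a₂))

  track-cast : ∀ {m n} (m≡n : m ≡ n) {u : Vec A m} {x : Vec A n} → u ≈[ m≡n ] x →
    (h : (l : ℕ) → Vec B l) → track u (h m) ≡ track x (h n)
  track-cast refl {u} u≈x h = cong (λ y → track y (h _)) (trans (sym (cast-is-id refl u)) u≈x)

  track-fromList-toList : ∀ {n} (x : Vec A n) (h : (l : ℕ) → Vec B l) →
    track (fromList (toList x)) (h (length (toList x))) ≡ track x (h n)
  track-fromList-toList x = track-cast (length-toList x) (fromList∘toList x)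

run : {A : Set} (M : DFA A) → Fin (DFA.states M) → List A → Fin (DFA.states M)
run M = foldl (DFA.step M)

module CutClasses {A B : Set} (M : DFA (A × B)) {ℓ₁ ℓ₂ : ℕ} (a : Vec B (ℓ₁ + ℓ₂)) where
  open DFA M

  stateAtCut : Vec A ℓ₁ → Fin states
  stateAtCut x₁ = run M start (track x₁ (take ℓ₁ a))

  AcceptedFrom : Fin states → Vec A ℓ₂ → Set
  AcceptedFrom q x₂ = T (accepting (run M q (track x₂ (drop ℓ₁ a))))

  SplitClass : Fin states → Vec A ℓ₁ → Vec A ℓ₂ → Set
  SplitClass q x₁ x₂ = stateAtCut x₁ ≡ q × AcceptedFrom q x₂

  CutClass : Fin states → Vec A (ℓ₁ + ℓ₂) → Set
  CutClass q x = SplitClass q (take ℓ₁ x) (drop ℓ₁ x)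

  CutClass-++ : ∀ q x₁ x₂ → CutClass q (x₁ ++ x₂) ≡ SplitClass q x₁ x₂
  CutClass-++ q x₁ x₂ = cong₂ (SplitClass q) (take-++ x₁ x₂) (drop-++ x₁ x₂)

  CutClass-disjoint : ∀ q r x → CutClass q x → CutClass r x → q ≡ r
  CutClass-disjoint q r x (cut≡q , _) (cut≡r , _) = trans (sym cut≡q) cut≡r

  CutClass-swap : ∀ q (x₁ y₁ : Vec A ℓ₁) (x₂ y₂ : Vec A ℓ₂) →
    CutClass q (x₁ ++ x₂) → CutClass q (y₁ ++ y₂) →
    CutClass q (x₁ ++ y₂) × CutClass q (y₁ ++ x₂)
  CutClass-swap q x₁ y₁ x₂ y₂ in-x in-y =
    let cut-x , acc-x = unfold x₁ x₂ in-x
        cut-y , acc-y = unfold y₁ y₂ in-y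
    in fold x₁ y₂ (cut-x , acc-y) , fold y₁ x₂ (cut-y , acc-x)
    where
    unfold : ∀ u₁ u₂ → CutClass q (u₁ ++ u₂) → SplitClass q u₁ u₂
    unfold u₁ u₂ = subst id (CutClass-++ q u₁ u₂)
    fold : ∀ u₁ u₂ → SplitClass q u₁ u₂ → CutClass q (u₁ ++ u₂)
    fold u₁ u₂ = subst id (sym (CutClass-++ q u₁ u₂))

  run-track-at-cut : ∀ q (x : Vec A (ℓ₁ + ℓ₂)) →
    run M q (track x a) ≡
    run M (run M q (track (take ℓ₁ x) (take ℓ₁ a))) (track (drop ℓ₁ x) (drop ℓ₁ a))
  run-track-at-cut q x = begin
    run M q (track x a)
      ≡⟨ cong₂ (λ y b → run M q (track y b)) (sym (take++drop≡id ℓ₁ x)) (sym (take++drop≡id ℓ₁ a)) ⟩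
    run M q (track (take ℓ₁ x ++ drop ℓ₁ x) (take ℓ₁ a ++ drop ℓ₁ a))
      ≡⟨ cong (run M q) (track-++ (take ℓ₁ x) (drop ℓ₁ x) (take ℓ₁ a) (drop ℓ₁ a)) ⟩
    run M q (track (take ℓ₁ x) (take ℓ₁ a) List.++ track (drop ℓ₁ x) (drop ℓ₁ a))
      ≡⟨ foldl-++ step q (track (take ℓ₁ x) (take ℓ₁ a)) (track (drop ℓ₁ x) (drop ℓ₁ a)) ⟩
    run M (run M q (track (take ℓ₁ x) (take ℓ₁ a))) (track (drop ℓ₁ x) (drop ℓ₁ a)) ∎
    where open ≡-Reasoning

  accepts⇔CutClass : ∀ x → Accepts M (track x a) ⇔ (∃[ q ] CutClass q x)
  accepts⇔CutClass x = mk⇔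
    (λ acc → stateAtCut (take ℓ₁ x) , refl , subst Final (run-track-at-cut start x) acc)
    (λ { (q , refl , acc) → subst Final (sym (run-track-at-cut start x)) acc })
    where
    Final : Fin states → Set
    Final q = T (accepting q)

member⇔track : ∀ {k g} {S : Language (Fin k)} {R : Language (Fin k × Fin g)}
  (h : (n : ℕ) → Vec (Fin g) n) →
  (∀ w → S w ⇔ R (track (fromList w) (h (length w)))) →
  ∀ {n} (x : Vec (Fin k) n) → S (toList x) ⇔ R (track x (h n))
member⇔track {S = S} {R} h S⇔R x =
  subst (λ w → S (toList x) ⇔ R w) (track-fromList-toList x h) (S⇔R (toList x))

lemma7p6 : (k : ℕ) (S : Language (Fin k)) → REG/n S →
    Σ ℕ λ m → 0 < m × ((ℓ₁ ℓ₂ : ℕ) →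
      Σ (Fin m → Vec (Fin k) (ℓ₁ + ℓ₂) → Set) λ P →
        ((∀ i j (x : Vec (Fin k) (ℓ₁ + ℓ₂)) → P i x → P j x → i ≡ j)
        × (∀ (x : Vec (Fin k) (ℓ₁ + ℓ₂)) → S (toList x) ⇔ (∃[ i ] P i x))
        × (∀ i (x₁ y₁ : Vec (Fin k) ℓ₁) (x₂ y₂ : Vec (Fin k) ℓ₂) →
             P i (x₁ ++ x₂) → P i (y₁ ++ y₂) → P i (x₁ ++ y₂) × P i (y₁ ++ x₂))))
lemma7p6 _ S (_ , h , R , (M , R⇔M) , S⇔R) =
  DFA.states M , >-nonZero⁻¹ _ {{nonZeroIndex (DFA.start M)}} , λ ℓ₁ ℓ₂ →
    let open CutClasses M {ℓ₁} {ℓ₂} (h (ℓ₁ + ℓ₂))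
        S⇔CutClass : ∀ x → S (toList x) ⇔ (∃[ q ] CutClass q x)
        S⇔CutClass x = ⇔-trans (member⇔track {R = R} h S⇔R x)
                               (⇔-trans (R⇔M (track x (h (ℓ₁ + ℓ₂)))) (accepts⇔CutClass x))
    in CutClass , CutClass-disjoint , S⇔CutClass , CutClass-swap
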